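{- In each of the four sequent calculi $\mathbf{G3}_{\mathsf N}$, $\mathbf{G3}_{\mathsf{NeF}}$, $\mathbf{G3}_{\mathsf{CoPC}}$, $\mathbf{G3}_{\mathsf{MPC}}$, the cut rule \[\frac{\Gamma\Rightarrow\alpha\qquad\Delta,\alpha\Rightarrow\varphi}{\Gamma,\Delta\Rightarrow\varphi}\] is admissible: for all finite multisets $\Gamma,\Delta$ and formulas $\alpha,\varphi$, if $\Gamma\Rightarrow\alpha$ and $\Delta,\alpha\Rightarrow\varphi$ are derivable in the calculus, then so is $\Gamma,\Delta\Rightarrow\varphi$.
   Context: Formulas are built from a countable set of propositional variables $p,q,\dots$ and the constant $\top$ (there is no $\bot$) using binary $\land,\lor,\to$ and unary $\neg$. A sequent is $\Gamma\Rightarrow\varphi$ with $\Gamma$ a finite multiset of formulas and $\varphi$ a single formula; $\Gamma,\Delta$ denotes multiset union. The positive rules are: (ax) $\Gamma,p\Rightarrow p$ for a propositional variable $p$; ($\top$) $\Gamma\Rightarrow\top$; ($\to$r) from $\Gamma,\alpha\Rightarrow\beta$ infer $\Gamma\Rightarrow\alpha\to\beta$; ($\to$l) from $\Gamma,\alpha\to\beta\Rightarrow\alpha$ and $\Gamma,\beta\Rightarrow\varphi$ infer $\Gamma,\alpha\to\beta\Rightarrow\varphi$; ($\land$r) from $\Gamma\Rightarrow\alpha$ and $\Gamma\Rightarrow\beta$ infer $\Gamma\Rightarrow\alpha\land\beta$; ($\land$l) from $\Gamma,\alpha,\beta\Rightarrow\varphi$ infer $\Gamma,\alpha\land\beta\Rightarrow\varphi$;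 ($\lor$r$_1$), ($\lor$r$_2$) from $\Gamma\Rightarrow\alpha$ (resp. $\Gamma\Rightarrow\beta$) infer $\Gamma\Rightarrow\alpha\lor\beta$; ($\lor$l) from $\Gamma,\alpha\Rightarrow\varphi$ and $\Gamma,\beta\Rightarrow\varphi$ infer $\Gamma,\alpha\lor\beta\Rightarrow\varphi$. The negation rules are: (n) from $\Gamma,\neg\alpha,\beta\Rightarrow\alpha$ and $\Gamma,\neg\alpha,\alpha\Rightarrow\beta$ infer $\Gamma,\neg\alpha\Rightarrow\neg\beta$; (nef) from $\Gamma,\neg\alpha\Rightarrow\alpha$ infer $\Gamma,\neg\alpha\Rightarrow\neg\beta$; (copc) from $\Gamma,\neg\alpha,\beta\Rightarrow\alpha$ infer $\Gamma,\neg\alpha\Rightarrow\neg\beta$; (an) from $\Gamma,\alpha\Rightarrow\neg\alpha$ infer $\Gamma\Rightarrow\neg\alpha$. The calculi (without any structural rules) are: $\mathbf{G3}_{\mathsf N}$ = positive rules + (n); $\mathbf{G3}_{\mathsf{NeF}}$ = positive rules + (n) + (nef); $\mathbf{G3}_{\mathsf{CoPC}}$ = positive rules + (copc); $\mathbf{G3}_{\mathsf{MPC}}$ = positive rules + (copc) + (an). -}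

module Defs where

open import Data.Nat using (ℕ)
open import Data.List using (List; []; _∷_; _++_)
open import Data.List.Relation.Binary.Permutation.Propositional using (_↭_)
open import Data.Product using (Σ; _×_)

data Fm : Set where
  var  : ℕ → Fm
  `⊤   : Fm
  _∧'_ : Fm → Fm → Fm
  _∨'_ : Fm → Fm → Fm
  _⇒'_ : Fm → Fm → Fm
  ¬'_  : Fm → Fm

-- Finite multisets of formulas are represented by lists; two lists denote
-- the same multiset iff they are permutations of each other (_↭_).
Ctx : Set
Ctx = List Fm

data Calculus : Set where
  G3N G3NeF G3CoPC G3MPC : Calculus

data HasN : Calculus → Set where
  n-N   : HasN G3N
  n-NeF : HasN G3NeF

data HasNeF : Calculus → Set where
  nef-NeF : HasNeF G3NeF

data HasCoPC : Calculus → Set where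
  copc-CoPC : HasCoPC G3CoPC
  copc-MPC  : HasCoPC G3MPC

data HasAN : Calculus → Set where
  an-MPC : HasAN G3MPC

data Der (c : Calculus) : Ctx → Fm → Set
-- A multiset sequent Γ ⇒ φ is derivable iff some list ordering of Γ has a
-- derivation (lists up to permutation = multisets; no structural rule
-- other than this identification is added).
Derivable : Calculus → Ctx → Fm → Set
Derivable c Γ φ = Σ Ctx (λ Γ' → (Γ' ↭ Γ) × Der c Γ' φ)

-- Derivations on list-represented sequents Γ ⇒ φ, where the principal
-- formula of a left rule is written at the head of the list.
data Der c where
  ax   : ∀ {Γ p} → Der c (var p ∷ Γ) (var p)
  top  : ∀ {Γ} → Der c Γ `⊤
  →r   : ∀ {Γ α β} → Derivable c (α ∷ Γ) β → Der c Γ (α ⇒' β)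
  →l   : ∀ {Γ α β φ} → Derivable c ((α ⇒' β) ∷ Γ) α → Derivable c (β ∷ Γ) φ
       → Der c ((α ⇒' β) ∷ Γ) φ
  ∧r   : ∀ {Γ α β} → Derivable c Γ α → Derivable c Γ β → Der c Γ (α ∧' β)
  ∧l   : ∀ {Γ α β φ} → Derivable c (α ∷ β ∷ Γ) φ → Der c ((α ∧' β) ∷ Γ) φ
  ∨r₁  : ∀ {Γ α β} → Derivable c Γ α → Der c Γ (α ∨' β)
  ∨r₂  : ∀ {Γ α β} → Derivable c Γ β → Der c Γ (α ∨' β)
  ∨l   : ∀ {Γ α β φ} → Derivable c (α ∷ Γ) φ → Derivable c (β ∷ Γ) φ
       → Der c ((α ∨' β) ∷ Γ) φ
  n    : ∀ {Γ α β} → HasN c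
       → Derivable c ((¬' α) ∷ β ∷ Γ) α → Derivable c ((¬' α) ∷ α ∷ Γ) β
       → Der c ((¬' α) ∷ Γ) (¬' β)
  nef  : ∀ {Γ α β} → HasNeF c
       → Derivable c ((¬' α) ∷ Γ) α
       → Der c ((¬' α) ∷ Γ) (¬' β)
  copc : ∀ {Γ α β} → HasCoPC c
       → Derivable c ((¬' α) ∷ β ∷ Γ) α
       → Der c ((¬' α) ∷ Γ) (¬' β)
  an   : ∀ {Γ α} → HasAN c
       → Derivable c (α ∷ Γ) (¬' α)
       → Der c Γ (¬' α)

--   1. Weakening is admissible.
--   2. The left rules for ∧, → and ∨ are invertible (for →, only the
--      right premise β is recovered); one lemma treats all four inversions.
--   3. Contraction is admissible.  Its principal cases use inversion
--      for ∧, →, ∨; the negation rules keep ¬α in their premises, so for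
--      them contraction simply moves into the premises.
--   4. Cut is admissible, by lexicographic recursion on the cut formula,
--      then the right derivation, then the left derivation.  If the cut
--      formula is not principal on the right, the cut is permuted into the
--      right premises; if it is principal there, either the left
--      derivation ends in a left rule (permute the cut into it) or both
--      sides introduce the cut formula, and the cut is replaced by cuts on
--      its immediate subformulas, with contraction removing the duplicated
--      context.  The negation cases pair the rules (n, nef, copc, an) as
--      each calculus allows; the remaining pairs are ruled out by the
--      calculus indices.

module Submission where

open import Defs
open import Data.Empty using (⊥; ⊥-elim)
open import Data.List using ([]; _∷_; _++_; [_])
open import Data.List.Membership.Propositional.Properties using (∈-∃++)
open import Data.List.Relation.Unary.Any using (here; there)
open import Data.List.Relation.Binary.Permutation.Propositional
open import Data.List.Relation.Binary.Permutation.Propositional.Properties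
  using (shift; shifts; drop-∷; ++⁺ˡ; ++⁺ʳ; ∈-resp-↭; ++-comm; ++-identityʳ; ++-commutativeMonoid)
open import Data.Nat using (ℕ)
open import Data.Product using (_,_)
open import Relation.Binary.PropositionalEquality using (_≡_; refl)
open import Algebra.Solver.CommutativeMonoid (++-commutativeMonoid {A = Fm})
  using (solve; _⊜_; _⊕_)

private
  variable
    c : Calculus
    A B F x α β γ δ φ ψ : Fm
    Γ Γ' Γ₀ Δ Δ₀ Θ Ξ R : Ctx


exchange : Derivable c Γ φ → Γ ↭ Γ' → Derivable c Γ' φ
exchange (Ξ , Ξ↭Γ , d) Γ↭Γ' = Ξ , trans Ξ↭Γ Γ↭Γ' , d

derived : Der c Γ φ → Derivable c Γ φ
derived d = _ , refl , d

data Located (x A : Fm) (Γ Δ : Ctx) : Set where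
  same  : x ≡ A → Γ ↭ Δ → Located x A Γ Δ
  other : (Δ₀ : Ctx) → Γ ↭ A ∷ Δ₀ → Δ ↭ x ∷ Δ₀ → Located x A Γ Δ

locate : x ∷ Γ ↭ A ∷ Δ → Located x A Γ Δ
locate {x} {A = A} p with ∈-resp-↭ (↭-sym p) (here refl)
... | here refl = same refl (drop-∷ p)
... | there A∈Γ with ∈-∃++ A∈Γ
... | ys , zs , refl = other (ys ++ zs) (shift A ys zs)
        (↭-sym (drop-∷ (trans (swap A x refl) (trans (prep x (↭-sym (shift A ys zs))) p))))

data Located₂ (x A : Fm) (Γ Δ : Ctx) : Set where
  same  : x ≡ A → Γ ↭ A ∷ Δ → Located₂ x A Γ Δ
  other : (Δ₀ : Ctx) → Γ ↭ A ∷ A ∷ Δ₀ → Δ ↭ x ∷ Δ₀ → Located₂ x A Γ Δ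

locate₂ : x ∷ Γ ↭ A ∷ A ∷ Δ → Located₂ x A Γ Δ
locate₂ p with locate p
... | same eq q = same eq q
... | other Δ₁ q₁ q₂ with locate (↭-sym q₂)
...   | same refl r = same refl (trans q₁ (prep _ r))
...   | other Δ₀ r₁ r₂ = other Δ₀ (trans q₁ (prep _ r₁)) r₂

-- A premise extends the conclusion's context Θ by Λ.  into-premise brings
-- a block S of Θ to the front of the premise's context; out-of-premise moves
-- the block L that replaced it back behind Λ.
into-premise : (S Λ : Ctx) → Ξ ↭ Λ ++ Θ → Θ ↭ S ++ Δ → Ξ ↭ S ++ Λ ++ Δ
into-premise S Λ q p = trans q (trans (++⁺ˡ Λ p) (shifts Λ S))

out-of-premise : (L Λ : Ctx) → Derivable c (L ++ Λ ++ Δ) φ → Derivable c (Λ ++ L ++ Δ) φ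
out-of-premise L Λ e = exchange e (shifts L Λ)

reattach : (L : Ctx) → Der c (x ∷ L ++ Δ₀) φ → Δ ↭ x ∷ Δ₀ → Derivable c (L ++ Δ) φ
reattach {x = x} {Δ₀ = Δ₀} L d q = _ , ↭-sym (trans (++⁺ˡ L q) (shift x L Δ₀)) , d

past-two : (x a b : Fm) (Γ : Ctx) → x ∷ a ∷ b ∷ Γ ↭ a ∷ b ∷ x ∷ Γ
past-two x a b Γ = ↭-sym (shift x (a ∷ b ∷ []) Γ)


mutual
  weaken-Der : (x : Fm) → Der c Γ φ → Derivable c (x ∷ Γ) φ
  weaken-Der x ax          = _ , swap _ _ refl , ax
  weaken-Der x top         = derived top
  weaken-Der x (→r e)      = derived (→r (exchange (weaken x e) (swap _ _ refl)))
  weaken-Der x (→l e₁ e₂)  = _ , swap _ _ refl ,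
    →l (exchange (weaken x e₁) (swap _ _ refl)) (exchange (weaken x e₂) (swap _ _ refl))
  weaken-Der x (∧r e₁ e₂)  = derived (∧r (weaken x e₁) (weaken x e₂))
  weaken-Der x (∧l e)      = _ , swap _ _ refl , ∧l (exchange (weaken x e) (past-two _ _ _ _))
  weaken-Der x (∨r₁ e)     = derived (∨r₁ (weaken x e))
  weaken-Der x (∨r₂ e)     = derived (∨r₂ (weaken x e))
  weaken-Der x (∨l e₁ e₂)  = _ , swap _ _ refl ,
    ∨l (exchange (weaken x e₁) (swap _ _ refl)) (exchange (weaken x e₂) (swap _ _ refl))
  weaken-Der x (n h e₁ e₂) = _ , swap _ _ refl ,
    n h (exchange (weaken x e₁) (past-two _ _ _ _)) (exchange (weaken x e₂) (past-two _ _ _ _))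
  weaken-Der x (nef h e)   = _ , swap _ _ refl , nef h (exchange (weaken x e) (swap _ _ refl))
  weaken-Der x (copc h e)  = _ , swap _ _ refl , copc h (exchange (weaken x e) (past-two _ _ _ _))
  weaken-Der x (an h e)    = derived (an h (exchange (weaken x e) (swap _ _ refl)))

  weaken : (x : Fm) → Derivable c Γ φ → Derivable c (x ∷ Γ) φ
  weaken x (Ξ , q , d) = exchange (weaken-Der x d) (prep x q)

weaken-suffix : (Λ : Ctx) → Derivable c Γ φ → Derivable c (Γ ++ Λ) φ
weaken-suffix {Γ = Γ} Λ e = exchange (weaken-prefix Λ) (++-comm Λ Γ)
  where
  weaken-prefix : (Λ : Ctx) → Derivable _ (Λ ++ Γ) _
  weaken-prefix []      = e
  weaken-prefix (x ∷ Λ) = weaken x (weaken-prefix Λ)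


-- The invertible left rules: an occurrence of F may be replaced by R.
data Invertible : Fm → Ctx → Set where
  ∧-inv  : Invertible (A ∧' B) (A ∷ B ∷ [])
  ⇒-inv  : Invertible (A ⇒' B) (B ∷ [])
  ∨-inv₁ : Invertible (A ∨' B) (A ∷ [])
  ∨-inv₂ : Invertible (A ∨' B) (B ∷ [])

atom-not-invertible : {p : ℕ} → Invertible (var p) R → ⊥
atom-not-invertible ()

negation-not-invertible : Invertible (¬' A) R → ⊥
negation-not-invertible ()

-- Inversion: from a derivation of F, Δ ⇒ φ obtain one of R, Δ ⇒ φ.  When F
-- is principal the wanted derivation is a premise; otherwise invert in the
-- premises and re-apply the rule.
mutual
  invert : Invertible F R → Der c Θ φ → Θ ↭ F ∷ Δ → Derivable c (R ++ Δ) φ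
  invert i top p         = derived top
  invert i (→r e) p      = derived (→r (invert-premise i [ _ ] e p))
  invert i (∧r e₁ e₂) p  = derived (∧r (invert-premise i [] e₁ p) (invert-premise i [] e₂ p))
  invert i (∨r₁ e) p     = derived (∨r₁ (invert-premise i [] e p))
  invert i (∨r₂ e) p     = derived (∨r₂ (invert-premise i [] e p))
  invert i (an h e) p    = derived (an h (invert-premise i [ _ ] e p))
  invert {R = R} i ax p with locate p
  ... | same refl _      = ⊥-elim (atom-not-invertible i)
  ... | other _ _ q      = reattach R ax q
  invert {R = R} i (→l e₁ e₂) p with locate p
  ... | same refl q      = invert-→l i e₂ q
  ... | other _ q₁ q     = reattach R (→l (invert-premise i [ _ ] e₁ q₁) (invert-premise i [ _ ] e₂ q₁)) q
  invert {R = R} i (∧l e) p with locate p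
  ... | same refl q      = invert-∧l i e q
  ... | other _ q₁ q     = reattach R (∧l (invert-premise i (_ ∷ _ ∷ []) e q₁)) q
  invert {R = R} i (∨l e₁ e₂) p with locate p
  ... | same refl q      = invert-∨l i e₁ e₂ q
  ... | other _ q₁ q     = reattach R (∨l (invert-premise i [ _ ] e₁ q₁) (invert-premise i [ _ ] e₂ q₁)) q
  invert {R = R} i (n h e₁ e₂) p with locate p
  ... | same refl _      = ⊥-elim (negation-not-invertible i)
  ... | other _ q₁ q     =
    reattach R (n h (invert-premise i (_ ∷ _ ∷ []) e₁ q₁) (invert-premise i (_ ∷ _ ∷ []) e₂ q₁)) q
  invert {R = R} i (nef h e) p with locate p
  ... | same refl _      = ⊥-elim (negation-not-invertible i)
  ... | other _ q₁ q     = reattach R (nef h (invert-premise i [ _ ] e q₁)) q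
  invert {R = R} i (copc h e) p with locate p
  ... | same refl _      = ⊥-elim (negation-not-invertible i)
  ... | other _ q₁ q     = reattach R (copc h (invert-premise i (_ ∷ _ ∷ []) e q₁)) q

  invert-premise : Invertible F R → (Λ : Ctx) → Derivable c (Λ ++ Θ) ψ → Θ ↭ F ∷ Δ
                 → Derivable c (Λ ++ R ++ Δ) ψ
  invert-premise {R = R} i Λ (Ξ , q , d) p = out-of-premise R Λ (invert i d (into-premise [ _ ] Λ q p))

  invert-→l : Invertible (A ⇒' B) R → Derivable c (B ∷ Γ) φ → Γ ↭ Δ → Derivable c (R ++ Δ) φ
  invert-→l ⇒-inv e q = exchange e (prep _ q)

  invert-∧l : Invertible (A ∧' B) R → Derivable c (A ∷ B ∷ Γ) φ → Γ ↭ Δ → Derivable c (R ++ Δ) φ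
  invert-∧l ∧-inv e q = exchange e (prep _ (prep _ q))

  invert-∨l : Invertible (A ∨' B) R → Derivable c (A ∷ Γ) φ → Derivable c (B ∷ Γ) φ → Γ ↭ Δ
            → Derivable c (R ++ Δ) φ
  invert-∨l ∨-inv₁ e₁ e₂ q = exchange e₁ (prep _ q)
  invert-∨l ∨-inv₂ e₁ e₂ q = exchange e₂ (prep _ q)

invert-derivable : Invertible F R → Derivable c Θ φ → Θ ↭ F ∷ Δ → Derivable c (R ++ Δ) φ
invert-derivable i (Ξ , q , d) p = invert i d (trans q p)


-- For a principal ∧, → or ∨
-- the other copy is inverted and the resulting copies of the (smaller)
-- subformulas are contracted.
mutual
  contract : (A : Fm) → Der c Θ φ → Θ ↭ A ∷ A ∷ Δ → Derivable c (A ∷ Δ) φ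
  contract A top p        = derived top
  contract A (→r e) p     = derived (→r (contract-premise A [ _ ] e p))
  contract A (∧r e₁ e₂) p = derived (∧r (contract-premise A [] e₁ p) (contract-premise A [] e₂ p))
  contract A (∨r₁ e) p    = derived (∨r₁ (contract-premise A [] e p))
  contract A (∨r₂ e) p    = derived (∨r₂ (contract-premise A [] e p))
  contract A (an h e) p   = derived (an h (contract-premise A [ _ ] e p))
  contract A ax p with locate₂ p
  ... | same refl _      = derived ax
  ... | other _ _ q      = reattach [ A ] ax q
  contract A (→l e₁ e₂) p with locate₂ p
  ... | same refl q      =
    derived (→l (contract-derivable _ e₁ (prep _ q))
                (contract-derivable _ (invert-derivable ⇒-inv e₂ (trans (prep _ q) (swap _ _ refl))) refl))
  ... | other _ q₁ q     =
    reattach [ A ] (→l (contract-premise A [ _ ] e₁ q₁) (contract-premise A [ _ ] e₂ q₁)) q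
  contract A (∧l e) p with locate₂ p
  ... | same refl q      = derived (∧l (contract-∧ (invert-derivable ∧-inv e (into-premise [ _ ] (_ ∷ _ ∷ []) refl q))))
  ... | other _ q₁ q     = reattach [ A ] (∧l (contract-premise A (_ ∷ _ ∷ []) e q₁)) q
  contract A (∨l e₁ e₂) p with locate₂ p
  ... | same refl q      =
    derived (∨l (contract-derivable _ (invert-derivable ∨-inv₁ e₁ (trans (prep _ q) (swap _ _ refl))) refl)
                (contract-derivable _ (invert-derivable ∨-inv₂ e₂ (trans (prep _ q) (swap _ _ refl))) refl))
  ... | other _ q₁ q     =
    reattach [ A ] (∨l (contract-premise A [ _ ] e₁ q₁) (contract-premise A [ _ ] e₂ q₁)) q
  contract A (n h e₁ e₂) p with locate₂ p
  ... | same refl q      =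
    derived (n h (contract-premise _ [] e₁ (prep _ (trans (prep _ q) (swap _ _ refl))))
                 (contract-premise _ [] e₂ (prep _ (trans (prep _ q) (swap _ _ refl)))))
  ... | other _ q₁ q     =
    reattach [ A ] (n h (contract-premise A (_ ∷ _ ∷ []) e₁ q₁) (contract-premise A (_ ∷ _ ∷ []) e₂ q₁)) q
  contract A (nef h e) p with locate₂ p
  ... | same refl q      = derived (nef h (contract-premise _ [] e (prep _ q)))
  ... | other _ q₁ q     = reattach [ A ] (nef h (contract-premise A [ _ ] e q₁)) q
  contract A (copc h e) p with locate₂ p
  ... | same refl q      = derived (copc h (contract-premise _ [] e (prep _ (trans (prep _ q) (swap _ _ refl)))))
  ... | other _ q₁ q     = reattach [ A ] (copc h (contract-premise A (_ ∷ _ ∷ []) e q₁)) q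

  contract-premise : (A : Fm) (Λ : Ctx) → Derivable c (Λ ++ Θ) ψ → Θ ↭ A ∷ A ∷ Δ
                   → Derivable c (Λ ++ A ∷ Δ) ψ
  contract-premise A Λ (Ξ , q , d) p = out-of-premise [ A ] Λ (contract A d (into-premise (A ∷ A ∷ []) Λ q p))

  contract-derivable : (A : Fm) → Derivable c Θ φ → Θ ↭ A ∷ A ∷ Δ → Derivable c (A ∷ Δ) φ
  contract-derivable A (Ξ , q , d) p = contract A d (trans q p)

  contract-∧ : Derivable c (A ∷ B ∷ A ∷ B ∷ Δ) φ → Derivable c (A ∷ B ∷ Δ) φ
  contract-∧ {A = A} {B = B} {Δ = Δ} e =
    exchange (contract-derivable _ (contract-derivable _ e (prep _ (shift A [ B ] (B ∷ Δ))))
                                   (past-two A B B Δ))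
             (swap _ _ refl)

contract-prefix : (Λ : Ctx) {Ω : Ctx} → Derivable c (Λ ++ Λ ++ Ω) φ → Derivable c (Λ ++ Ω) φ
contract-prefix []      e = e
contract-prefix (x ∷ Λ) {Ω} e =
  exchange (contract-prefix Λ (exchange (contract-derivable x e (prep x (shift x Λ (Λ ++ Ω))))
                                        (solve 3 (λ X L O → X ⊕ L ⊕ L ⊕ O ⊜ L ⊕ L ⊕ X ⊕ O) refl [ x ] Λ Ω)))
           (shift x Λ Ω)

contract-copy : (Λ : Ctx) → Derivable c (Λ ++ Λ) φ → Derivable c Λ φ
contract-copy Λ e =
  exchange (contract-prefix Λ (exchange e (↭-sym (++⁺ˡ Λ (++-identityʳ Λ))))) (++-identityʳ Λ)


mutual
  cut : Der c Γ α → Der c Θ φ → Θ ↭ α ∷ Δ → Derivable c (Γ ++ Δ) φ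
  cut d top p        = derived top
  cut d (→r e) p     = derived (→r (cut-premise d [ _ ] e p))
  cut d (∧r e₁ e₂) p = derived (∧r (cut-premise d [] e₁ p) (cut-premise d [] e₂ p))
  cut d (∨r₁ e) p    = derived (∨r₁ (cut-premise d [] e p))
  cut d (∨r₂ e) p    = derived (∨r₂ (cut-premise d [] e p))
  cut d (an h e) p   = derived (an h (cut-premise d [ _ ] e p))
  cut {Γ = Γ} d ax p with locate p
  ... | same refl _    = weaken-suffix _ (derived d)
  ... | other _ _ q    = reattach Γ ax q
  cut {Γ = Γ} d (→l e₁ e₂) p with locate p
  ... | same eq q      = reduce-→ eq d (→l e₁ e₂) e₁ e₂ q
  ... | other _ q₁ q   = reattach Γ (→l (cut-premise d [ _ ] e₁ q₁) (cut-premise d [ _ ] e₂ q₁)) q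
  cut {Γ = Γ} d (∧l e) p with locate p
  ... | same eq q      = reduce-∧ eq d (∧l e) e q
  ... | other _ q₁ q   = reattach Γ (∧l (cut-premise d (_ ∷ _ ∷ []) e q₁)) q
  cut {Γ = Γ} d (∨l e₁ e₂) p with locate p
  ... | same eq q      = reduce-∨ eq d (∨l e₁ e₂) e₁ e₂ q
  ... | other _ q₁ q   = reattach Γ (∨l (cut-premise d [ _ ] e₁ q₁) (cut-premise d [ _ ] e₂ q₁)) q
  cut {Γ = Γ} d (n h e₁ e₂) p with locate p
  ... | same eq q      = reduce-n eq h d (n h e₁ e₂) e₁ e₂ q
  ... | other _ q₁ q   =
    reattach Γ (n h (cut-premise d (_ ∷ _ ∷ []) e₁ q₁) (cut-premise d (_ ∷ _ ∷ []) e₂ q₁)) q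
  cut {Γ = Γ} d (nef h e) p with locate p
  ... | same eq q      = reduce-nef eq h d (nef h e) e q
  ... | other _ q₁ q   = reattach Γ (nef h (cut-premise d [ _ ] e q₁)) q
  cut {Γ = Γ} d (copc h e) p with locate p
  ... | same eq q      = reduce-copc eq h d (copc h e) e q
  ... | other _ q₁ q   = reattach Γ (copc h (cut-premise d (_ ∷ _ ∷ []) e q₁)) q

  cut-premise : Der c Γ α → (Λ : Ctx) → Derivable c (Λ ++ Θ) ψ → Θ ↭ α ∷ Δ
              → Derivable c (Λ ++ Γ ++ Δ) ψ
  cut-premise {Γ = Γ} d Λ (Ξ , q , d′) p = out-of-premise Γ Λ (cut d d′ (into-premise [ _ ] Λ q p))

  cut-left : Derivable c Γ α → Der c Θ φ → Θ ↭ α ∷ Δ → Derivable c (Γ ++ Δ) φ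
  cut-left (Ξ , q , d) d′ p = exchange (cut d d′ p) (++⁺ʳ _ q)

  cut-right : Der c Γ α → Derivable c Θ φ → Θ ↭ α ∷ Δ → Derivable c (Γ ++ Δ) φ
  cut-right d (Ξ , q , d′) p = cut d d′ (trans q p)

  cut-derivable : Derivable c Γ α → Derivable c Θ φ → Θ ↭ α ∷ Δ → Derivable c (Γ ++ Δ) φ
  cut-derivable (Ξ , q , d) e p = exchange (cut-right d e p) (++⁺ʳ _ q)

  commute-→l : Derivable c ((A ⇒' B) ∷ Γ) A → Derivable c (B ∷ Γ) α → Der c Θ φ → Θ ↭ α ∷ Δ
             → Derivable c ((A ⇒' B) ∷ Γ ++ Δ) φ
  commute-→l {Δ = Δ} e₁ e₂ d p = derived (→l (weaken-suffix Δ e₁) (cut-left e₂ d p))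

  commute-∧l : Derivable c (A ∷ B ∷ Γ) α → Der c Θ φ → Θ ↭ α ∷ Δ → Derivable c ((A ∧' B) ∷ Γ ++ Δ) φ
  commute-∧l e d p = derived (∧l (cut-left e d p))

  commute-∨l : Derivable c (A ∷ Γ) α → Derivable c (B ∷ Γ) α → Der c Θ φ → Θ ↭ α ∷ Δ
             → Derivable c ((A ∨' B) ∷ Γ ++ Δ) φ
  commute-∨l e₁ e₂ d p = derived (∨l (cut-left e₁ d p) (cut-left e₂ d p))

  -- Each receives the equation between the
  -- principal formula on the right and α instead of instantiating α at the
  -- call site, so that α is matched here as a constructor pattern and the
  -- cuts on its immediate subformulas are seen to be structurally smaller.
  -- The whole right derivation is passed along for the cases where the left
  -- derivation ends in a left rule and the cut is permuted into it.

  -- A ⇒ B principal on both sides: Γ, Δ ⇒ A (cut A ⇒ B into the left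
  -- premise of →l) and A, Γ, Δ ⇒ φ (cut B), then cut A and contract Γ, Δ.
  reduce-→ : A ⇒' B ≡ α → Der c Γ α → Der c ((A ⇒' B) ∷ Θ) φ
           → Derivable c ((A ⇒' B) ∷ Θ) A → Derivable c (B ∷ Θ) φ → Θ ↭ Δ → Derivable c (Γ ++ Δ) φ
  reduce-→ {α = _ ⇒' _} {Γ = Γ} {Δ = Δ} refl (→r e) d e₁ e₂ q =
    let ⊢A   = cut-right (→r e) e₁ (prep _ q)
        A⊢φ  = cut-derivable e e₂ (prep _ q)
    in contract-copy (Γ ++ Δ) (cut-derivable ⊢A A⊢φ refl)
  reduce-→ refl (→l f₁ f₂) d e₁ e₂ q = commute-→l f₁ f₂ d (prep _ q)
  reduce-→ refl (∧l f) d e₁ e₂ q     = commute-∧l f d (prep _ q)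
  reduce-→ refl (∨l f₁ f₂) d e₁ e₂ q = commute-∨l f₁ f₂ d (prep _ q)

  -- A ∧ B principal on both sides: cut B, then A, and contract Γ.
  reduce-∧ : A ∧' B ≡ α → Der c Γ α → Der c ((A ∧' B) ∷ Θ) φ
           → Derivable c (A ∷ B ∷ Θ) φ → Θ ↭ Δ → Derivable c (Γ ++ Δ) φ
  reduce-∧ {A = A} {B = B} {α = _ ∧' _} {Γ = Γ} {Δ = Δ} refl (∧r f₁ f₂) d e q =
    contract-prefix Γ (cut-derivable f₁ (cut-derivable f₂ e (trans (prep _ (prep _ q)) (swap A B refl)))
                                        (shift A Γ Δ))
  reduce-∧ refl (→l f₁ f₂) d e q = commute-→l f₁ f₂ d (prep _ q)
  reduce-∧ refl (∧l f) d e q     = commute-∧l f d (prep _ q)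
  reduce-∧ refl (∨l f₁ f₂) d e q = commute-∨l f₁ f₂ d (prep _ q)

  reduce-∨ : A ∨' B ≡ α → Der c Γ α → Der c ((A ∨' B) ∷ Θ) φ
           → Derivable c (A ∷ Θ) φ → Derivable c (B ∷ Θ) φ → Θ ↭ Δ → Derivable c (Γ ++ Δ) φ
  reduce-∨ {α = _ ∨' _} refl (∨r₁ f) d e₁ e₂ q    = cut-derivable f e₁ (prep _ q)
  reduce-∨ {α = _ ∨' _} refl (∨r₂ f) d e₁ e₂ q    = cut-derivable f e₂ (prep _ q)
  reduce-∨ refl (→l f₁ f₂) d e₁ e₂ q = commute-→l f₁ f₂ d (prep _ q)
  reduce-∨ refl (∧l f) d e₁ e₂ q     = commute-∧l f d (prep _ q)
  reduce-∨ refl (∨l f₁ f₂) d e₁ e₂ q = commute-∨l f₁ f₂ d (prep _ q)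

  -- The step shared by the negation reductions (taking ¬γ ≡ α for the
  -- same reason as the reductions themselves).  The left side derives ¬γ
  -- from ¬δ, Γ₀ and has a premise ¬δ, γ, Γ₀ ⇒ δ; the right side has a
  -- premise ¬γ, Λ, Θ ⇒ γ.  Cutting ¬γ and then γ, and contracting ¬δ, Γ₀,
  -- gives the premise ¬δ, Λ, Γ₀, Δ ⇒ δ of the reduced negation rule.
  chain-premises : ¬' γ ≡ α → (Λ : Ctx) → Der c ((¬' δ) ∷ Γ₀) α → Derivable c (α ∷ Λ ++ Θ) γ
                 → Derivable c ((¬' δ) ∷ γ ∷ Γ₀) δ → Θ ↭ Δ → Derivable c ((¬' δ) ∷ Λ ++ Γ₀ ++ Δ) δ
  chain-premises {α = ¬' _} {δ = δ} {Γ₀ = Γ₀} {Δ = Δ} refl Λ d e f q =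
    let Γ   = (¬' δ) ∷ Γ₀
        ⊢γ  = cut-right d e (prep _ (++⁺ˡ Λ q))
        ⊢δ  = cut-derivable ⊢γ f (swap _ _ refl)
    in exchange (contract-prefix Γ (exchange ⊢δ (++-comm (Γ ++ Λ ++ Δ) Γ))) (prep _ (shifts Γ₀ Λ))

  reduce-n : ¬' γ ≡ α → HasN c → Der c Γ α → Der c ((¬' γ) ∷ Θ) (¬' β)
           → Derivable c ((¬' γ) ∷ β ∷ Θ) γ → Derivable c ((¬' γ) ∷ γ ∷ Θ) β → Θ ↭ Δ
           → Derivable c (Γ ++ Δ) (¬' β)
  reduce-n {γ = γ} {α = ¬' _} {Δ = Δ} refl h (n {Γ₀} {δ} h′ f₁ f₂) d e₁ e₂ q =
    let ⊢β  = cut-right (n h′ f₁ f₂) e₂ (prep _ (prep _ q))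
        ⊢β′ = cut-derivable f₂ ⊢β (shift γ ((¬' δ) ∷ Γ₀) Δ)
        δ⊢β = exchange (contract-prefix ((¬' δ) ∷ Γ₀)
                         (exchange ⊢β′ (solve 4 (λ N D G X → (N ⊕ D ⊕ G) ⊕ (N ⊕ G) ⊕ X ⊜ (N ⊕ G) ⊕ (N ⊕ G) ⊕ D ⊕ X)
                                                refl [ ¬' δ ] [ δ ] Γ₀ Δ)))
                       (prep _ (shift δ Γ₀ Δ))
    in derived (n h′ (chain-premises refl [ _ ] (n h′ f₁ f₂) e₁ f₁ q) δ⊢β)
  reduce-n refl h (nef h′ f) d e₁ e₂ q          = derived (nef h′ (weaken-suffix _ f))
  reduce-n refl n-N (copc () f) d e₁ e₂ q
  reduce-n refl n-NeF (copc () f) d e₁ e₂ q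
  reduce-n refl n-N (an () f) d e₁ e₂ q
  reduce-n refl n-NeF (an () f) d e₁ e₂ q
  reduce-n refl h (→l f₁ f₂) d e₁ e₂ q = commute-→l f₁ f₂ d (prep _ q)
  reduce-n refl h (∧l f) d e₁ e₂ q     = commute-∧l f d (prep _ q)
  reduce-n refl h (∨l f₁ f₂) d e₁ e₂ q = commute-∨l f₁ f₂ d (prep _ q)

  reduce-nef : ¬' γ ≡ α → HasNeF c → Der c Γ α → Der c ((¬' γ) ∷ Θ) (¬' β)
             → Derivable c ((¬' γ) ∷ Θ) γ → Θ ↭ Δ → Derivable c (Γ ++ Δ) (¬' β)
  reduce-nef {α = ¬' _} refl h (n h′ f₁ f₂) d e q = derived (nef h (chain-premises refl [] (n h′ f₁ f₂) e f₁ q))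
  reduce-nef refl h (nef h′ f) d e q   = derived (nef h′ (weaken-suffix _ f))
  reduce-nef refl nef-NeF (copc () f) d e q
  reduce-nef refl nef-NeF (an () f) d e q
  reduce-nef refl h (→l f₁ f₂) d e q   = commute-→l f₁ f₂ d (prep _ q)
  reduce-nef refl h (∧l f) d e q       = commute-∧l f d (prep _ q)
  reduce-nef refl h (∨l f₁ f₂) d e q   = commute-∨l f₁ f₂ d (prep _ q)

  -- Against an
  -- the left premise γ, Γ ⇒ ¬γ is cut with the whole right derivation, and
  -- the result with Γ, β, Δ ⇒ γ; contraction and an conclude.
  reduce-copc : ¬' γ ≡ α → HasCoPC c → Der c Γ α → Der c ((¬' γ) ∷ Θ) (¬' β)
              → Derivable c ((¬' γ) ∷ β ∷ Θ) γ → Θ ↭ Δ → Derivable c (Γ ++ Δ) (¬' β)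
  reduce-copc refl h (copc h′ f) d e q = derived (copc h′ (chain-premises refl [ _ ] (copc h′ f) e f q))
  reduce-copc {α = ¬' _} {Γ = Γ} {β = β} {Δ = Δ} refl h (an h′ f) d e q =
    let γ⊢¬β = cut-left f d (prep _ q)
        ⊢γ   = cut-right (an h′ f) e (prep _ (prep _ q))
        ⊢¬β  = cut-derivable ⊢γ γ⊢¬β refl
    in derived (an h′ (exchange (contract-prefix (Γ ++ Δ)
                                  (exchange ⊢¬β (solve 3 (λ G B D → (G ⊕ B ⊕ D) ⊕ G ⊕ D ⊜ (G ⊕ D) ⊕ (G ⊕ D) ⊕ B)
                                                         refl Γ [ β ] Δ)))
                                (++-comm (Γ ++ Δ) [ β ])))
  reduce-copc refl copc-CoPC (n () f₁ f₂) d e q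
  reduce-copc refl copc-MPC (n () f₁ f₂) d e q
  reduce-copc refl copc-CoPC (nef () f) d e q
  reduce-copc refl copc-MPC (nef () f) d e q
  reduce-copc refl h (→l f₁ f₂) d e q = commute-→l f₁ f₂ d (prep _ q)
  reduce-copc refl h (∧l f) d e q     = commute-∧l f d (prep _ q)
  reduce-copc refl h (∨l f₁ f₂) d e q = commute-∨l f₁ f₂ d (prep _ q)


theorem4p1 : (c : Calculus) (Γ Δ : Ctx) (α φ : Fm)
    → Derivable c Γ α → Derivable c (α ∷ Δ) φ → Derivable c (Γ ++ Δ) φ
theorem4p1 c Γ Δ α φ ⊢α α⊢φ = cut-derivable ⊢α α⊢φ refl
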